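{- Let $\Sigma$ be a finite alphabet, $k\in\mathbb{N}$, and $w,\tilde w\in\Sigma^*$ with $w\sim_k\tilde w$ and $\iota(w)=\iota(\tilde w)<k$, with $\alpha$-$\beta$-factorizations $w=\alpha_0\beta_1\alpha_1\cdots\beta_{\iota(w)}\alpha_{\iota(w)}$ and $\tilde w=\tilde\alpha_0\tilde\beta_1\tilde\alpha_1\cdots\tilde\beta_{\iota(w)}\tilde\alpha_{\iota(w)}$. Then for all $0\le i\le j\le\iota(w)$ we have $\alpha_i\beta_{i+1}\alpha_{i+1}\cdots\beta_j\alpha_j\sim_{k-\iota(w)+j-i}\tilde\alpha_i\tilde\beta_{i+1}\tilde\alpha_{i+1}\cdots\tilde\beta_j\tilde\alpha_j$.
   Context: A word $u$ is a scattered factor of $w$ if $u$ is obtained from $w$ by deleting some letters (keeping order). For $k\in\mathbb{N}_0$, $u\sim_k v$ iff $u$ and $v$ have exactly the same scattered factors of length at most $k$. $\iota(w)$ is the largest $\ell$ such that every word of $\Sigma^\ell$ is a scattered factor of $w$. The arch factorization of $w$ is the unique factorization $w=\mathrm{ar}_1(w)\cdots\mathrm{ar}_\ell(w)\mathrm{re}(w)$ where each arch contains every letter of $\Sigma$ and its last letter occurs exactly once in it, and $\mathrm{re}(w)$ does not contain every letter of $\Sigma$; $\ell=\iota(w)$. With $w^R$ the reversal, $\mathrm{ra}_i(w)\coloneqq(\mathrm{ar}_{\iota(w)-i+1}(w^R))^R$ and $\mathrm{er}(w)\coloneqq(\mathrm{re}(w^R))^R$. The $\alpha$-$\beta$-factorization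 is $w=\alpha_0\beta_1\alpha_1\cdots\beta_{\iota(w)}\alpha_{\iota(w)}$ with $\mathrm{ar}_i(w)=\alpha_{i-1}\beta_i$, $\mathrm{ra}_i(w)=\beta_i\alpha_i$ for $i\in\{1,\dots,\iota(w)\}$, $\alpha_0=\mathrm{er}(w)$, $\alpha_{\iota(w)}=\mathrm{re}(w)$. -}

module Defs where

open import Data.Nat using (ℕ; zero; suc; _+_; _∸_; _≤_; _<_)
open import Data.Fin using (Fin)
open import Data.List using (List; []; _∷_; _++_; [_]; length; reverse)
open import Data.List.Membership.Propositional using (_∈_; _∉_)
open import Data.Product using (Σ; ∃; ∃₂; _×_; _,_)
open import Relation.Nullary using (¬_)
open import Relation.Binary.PropositionalEquality using (_≡_)
import Data.List.Relation.Binary.Sublist.Propositional as SL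

Word : ℕ → Set
Word σ = List (Fin σ)

_≼_ : ∀ {σ} → Word σ → Word σ → Set
_≼_ {σ} u w = SL._⊆_ {A = Fin σ} u w

_∼[_]_ : ∀ {σ} → Word σ → ℕ → Word σ → Set
u ∼[ k ] v = ∀ x → length x ≤ k → (x ≼ u → x ≼ v) × (x ≼ v → x ≼ u)

Universal : ∀ {σ} → ℕ → Word σ → Set
Universal {σ} ℓ w = (u : Word σ) → length u ≡ ℓ → u ≼ w

IsIota : ∀ {σ} → Word σ → ℕ → Set
IsIota w ℓ = Universal ℓ w × (∀ m → Universal m w → m ≤ ℓ)

AllLetters : ∀ {σ} → Word σ → Set
AllLetters {σ} w = (x : Fin σ) → x ∈ w

IsArch : ∀ {σ} → Word σ → Set
IsArch {σ} a = AllLetters a × ∃₂ λ (a' : Word σ) (x : Fin σ) → (a ≡ a' ++ [ x ]) × x ∉ a'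

-- ar 1 ++ ar 2 ++ ... ++ ar n   (functions indexed from 1)
concatUpTo : ∀ {σ} → (ℕ → Word σ) → ℕ → Word σ
concatUpTo ar zero = []
concatUpTo ar (suc n) = concatUpTo ar n ++ ar (suc n)

ArchFact : ∀ {σ} → Word σ → ℕ → (ℕ → Word σ) → Word σ → Set
ArchFact w ℓ ar r =
  (w ≡ concatUpTo ar ℓ ++ r) ×
  (∀ i → 1 ≤ i → i ≤ ℓ → IsArch (ar i)) ×
  ¬ AllLetters r

segment : ∀ {σ} → (ℕ → Word σ) → (ℕ → Word σ) → ℕ → ℕ → Word σ
segment α β i zero = α i
segment α β i (suc d) = α i ++ (β (suc i) ++ segment α β (suc i) d)

-- α-β-factorization of w with ℓ = ι(w) arches:
-- α_0..α_ℓ given by α 0 .. α ℓ, β_1..β_ℓ given by β 1 .. β ℓ.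
-- ar/r: arch factorization of w; ar'/r': arch factorization of w^R,
-- so ra_i(w) = (ar'_{ℓ-i+1})^R and er(w) = (r')^R.
ABFact : ∀ {σ} → Word σ → ℕ → (ℕ → Word σ) → (ℕ → Word σ) → Set
ABFact {σ} w ℓ α β =
  Σ (ℕ → Word σ) λ ar → Σ (Word σ) λ r → ArchFact w ℓ ar r ×
  Σ (ℕ → Word σ) λ ar' → Σ (Word σ) λ r' → ArchFact (reverse w) ℓ ar' r' ×
  (w ≡ segment α β 0 ℓ) ×
  (∀ i → 1 ≤ i → i ≤ ℓ → ar i ≡ α (i ∸ 1) ++ β i) ×
  (∀ i → 1 ≤ i → i ≤ ℓ → reverse (ar' (ℓ ∸ i + 1)) ≡ β i ++ α i) ×
  (α 0 ≡ reverse r') ×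
  (α ℓ ≡ r)

-- Frame the segment α_i β_{i+1} ⋯ α_j of w as  w = P ++ segment ++ Q,  where P = ar_1 ⋯ ar_i
-- and Q = ra_{j+1} ⋯ ra_ℓ.  Every word of length i embeds into P and every word of length ℓ - j
-- into Q.  Conversely, the word p of last letters of the first i arches of w̃ is such that any
-- embedding of p ++ v into w̃ must use up all of P̃ before v starts (the last letter of an arch
-- occurs nowhere earlier in it), and symmetrically on the right.  So for u in the segment of w,
-- p ++ u ++ q has length at most k, embeds into w, hence into w̃, and there u is forced into the
-- segment of w̃.

module Submission where

open import Defs
open import Data.Nat using (ℕ; zero; suc; _+_; _∸_; _⊓_; _≤_; _<_; z≤n; s≤s)
open import Data.Nat.Properties
  using (+-comm; +-assoc; +-suc; m≤m+n; m≤n+m; m+n∸m≡n; m≤n⇒m⊓n≡m; m∸n+n≡m; m+[n∸m]≡n;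
         ≤-refl; ≤-trans; ≤-reflexive; <⇒≤; n≤1+n; +-monoʳ-≤; +-monoˡ-≤)
open import Data.Nat.Tactic.RingSolver using (solve-∀)
open import Data.List using ([]; _∷_; _++_; [_]; length; reverse; take; drop)
open import Data.List.Properties
  using (++-assoc; ++-identityʳ; length-++; length-take; length-drop; length-reverse;
         reverse-++; reverse-involutive; take++drop≡id)
open import Data.List.Membership.Propositional using (_∉_)
open import Data.List.Relation.Unary.Any using (here; there)
open import Data.List.Relation.Binary.Sublist.Propositional
  using (_∷ʳ_; from∈) renaming ([] to []ₛ; _∷_ to _∷ₛ_)
open import Data.List.Relation.Binary.Sublist.Propositional.Properties
  using (++⁺; ∷ˡ⁻; reverse⁺; reverse⁻)
open import Data.Product using (∃; ∃₂; _×_; _,_; proj₁; proj₂)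
open import Data.Empty using (⊥-elim)
open import Relation.Binary.PropositionalEquality
  using (_≡_; refl; sym; trans; cong; subst; subst₂; module ≡-Reasoning)

module _ {σ : ℕ} where

  private
    W : Set
    W = Word σ

  _≲[_]_ : W → ℕ → W → Set
  u ≲[ k ] v = ∀ x → length x ≤ k → x ≼ u → x ≼ v

  Universal-++ : ∀ {m n} {X Y : W} → Universal m X → Universal n Y → Universal (m + n) (X ++ Y)
  Universal-++ {m} {n} {X} {Y} univX univY u ∣u∣≡m+n =
    subst (_≼ (X ++ Y)) (take++drop≡id m u) (++⁺ (univX (take m u) ∣take∣) (univY (drop m u) ∣drop∣))
    where
    ∣take∣ : length (take m u) ≡ m
    ∣take∣ = trans (length-take m u) (trans (cong (m ⊓_) ∣u∣≡m+n) (m≤n⇒m⊓n≡m (m≤m+n m n)))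
    ∣drop∣ : length (drop m u) ≡ n
    ∣drop∣ = trans (length-drop m u) (trans (cong (_∸ m) ∣u∣≡m+n) (m+n∸m≡n m n))

  AllLetters⇒Universal1 : ∀ {a : W} → AllLetters a → Universal 1 a
  AllLetters⇒Universal1 all (x ∷ []) refl = from∈ (all x)

  Universal-reverse : ∀ {n} {X : W} → Universal n X → Universal n (reverse X)
  Universal-reverse {X = X} univX u ∣u∣≡n =
    subst (_≼ reverse X) (reverse-involutive u) (reverse⁺ (univX (reverse u) (trans (length-reverse u) ∣u∣≡n)))

  _Pinsˡ_ : W → W → Set
  p Pinsˡ P = ∀ {v rest} → (p ++ v) ≼ (P ++ rest) → v ≼ rest

  _Pinsʳ_ : W → W → Set
  q Pinsʳ Q = ∀ {u front} → (u ++ q) ≼ (front ++ Q) → u ≼ front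

  Pinsˡ-++ : ∀ {p P q Q : W} → p Pinsˡ P → q Pinsˡ Q → (p ++ q) Pinsˡ (P ++ Q)
  Pinsˡ-++ {p} {P} {q} {Q} pinP pinQ {v} {rest} emb =
    pinQ (pinP (subst₂ _≼_ (++-assoc p q v) (++-assoc P Q rest) emb))

  Pinsˡ-reverse : ∀ {p P : W} → p Pinsˡ P → reverse p Pinsʳ reverse P
  Pinsˡ-reverse {p} {P} pinP {u} {front} emb =
    reverse⁻ (pinP (subst₂ _≼_ (reverse-++-reverse u p) (reverse-++-reverse front P) (reverse⁺ emb)))
    where
    reverse-++-reverse : ∀ (xs ys : W) → reverse (xs ++ reverse ys) ≡ ys ++ reverse xs
    reverse-++-reverse xs ys = trans (reverse-++ xs (reverse ys)) (cong (_++ reverse xs) (reverse-involutive ys))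

  last-letter-pins : ∀ {x} (a : W) → x ∉ a → [ x ] Pinsˡ (a ++ [ x ])
  last-letter-pins []      x∉a (_ ∷ʳ emb)      = ∷ˡ⁻ emb
  last-letter-pins []      x∉a (_ ∷ₛ emb)      = emb
  last-letter-pins (y ∷ a) x∉a (.y ∷ʳ emb)     = last-letter-pins a (λ x∈a → x∉a (there x∈a)) emb
  last-letter-pins (y ∷ a) x∉a (x≡y ∷ₛ _)      = ⊥-elim (x∉a (here x≡y))

  arch-pinned : ∀ {a : W} → IsArch a → ∃ λ x → [ x ] Pinsˡ a
  arch-pinned (_ , a , x , refl , x∉a) = x , last-letter-pins a x∉a

  Tightˡ : ℕ → W → Set
  Tightˡ n P = Universal n P × ∃ λ p → length p ≡ n × p Pinsˡ P

  Tightʳ : ℕ → W → Set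
  Tightʳ n Q = Universal n Q × ∃ λ q → length q ≡ n × q Pinsʳ Q

  Tightˡ-reverse : ∀ {n} {P : W} → Tightˡ n P → Tightʳ n (reverse P)
  Tightˡ-reverse (univ , p , ∣p∣≡n , pin) =
    Universal-reverse univ , reverse p , trans (length-reverse p) ∣p∣≡n , Pinsˡ-reverse pin

  Arches : (ℕ → W) → ℕ → Set
  Arches ar n = ∀ t → 1 ≤ t → t ≤ n → IsArch (ar t)

  Arches-≤ : ∀ {ar m n} → m ≤ n → Arches ar n → Arches ar m
  Arches-≤ m≤n arches t 1≤t t≤m = arches t 1≤t (≤-trans t≤m m≤n)

  arches-tight : ∀ {ar} n → Arches ar n → Tightˡ n (concatUpTo ar n)
  arches-tight zero    arches = (λ { [] refl → []ₛ }) , [] , refl , λ emb → emb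
  arches-tight {ar} (suc n) arches
    with arches-tight n (Arches-≤ (n≤1+n n) arches) | arches (suc n) (s≤s z≤n) ≤-refl
  ... | univ , p , ∣p∣≡n , pin | arch with arch-pinned arch
  ... | x , pin-x =
    subst (λ m → Universal m (concatUpTo ar (suc n))) (+-comm n 1)
          (Universal-++ univ (AllLetters⇒Universal1 (proj₁ arch))) ,
    p ++ [ x ] , trans (length-++ p) (trans (+-comm (length p) 1) (cong suc ∣p∣≡n)) , Pinsˡ-++ pin pin-x

  Framed : ℕ → ℕ → W → W → Set
  Framed i e w M = ∃₂ λ P Q → (w ≡ P ++ M ++ Q) × Tightˡ i P × Tightʳ e Q

  framed-≲ : ∀ {k n i e} {w w̃ M M̃ : W} → w ≲[ k ] w̃ → Framed i e w M → Framed i e w̃ M̃ →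
             i + (n + e) ≤ k → M ≲[ n ] M̃
  framed-≲ {k = k} {i = i} {e = e} w≲w̃ (P , Q , refl , (univP , _) , (univQ , _))
           (P̃ , Q̃ , refl , (_ , p , ∣p∣≡i , pinP̃) , (_ , q , ∣q∣≡e , pinQ̃)) bound u ∣u∣≤n u≼M =
    pinQ̃ (pinP̃ (w≲w̃ (p ++ u ++ q) ∣puq∣≤k (++⁺ (univP p ∣p∣≡i) (++⁺ u≼M (univQ q ∣q∣≡e)))))
    where
    ∣puq∣≤k : length (p ++ u ++ q) ≤ k
    ∣puq∣≤k = ≤-trans (≤-reflexive ∣puq∣) (≤-trans (+-monoʳ-≤ i (+-monoˡ-≤ e ∣u∣≤n)) bound)
      where
      ∣puq∣ : length (p ++ u ++ q) ≡ i + (length u + e)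
      ∣puq∣ rewrite length-++ p {u ++ q} | length-++ u {q} | ∣p∣≡i | ∣q∣≡e = refl

module _ {σ : ℕ} (α β : ℕ → Word σ) where

  open ≡-Reasoning

  arches++segment : ∀ {ℓ} (ar : ℕ → Word σ) → (∀ t → 1 ≤ t → t ≤ ℓ → ar t ≡ α (t ∸ 1) ++ β t) →
                    ∀ i d → i ≤ ℓ → concatUpTo ar i ++ segment α β i d ≡ segment α β 0 (i + d)
  arches++segment ar ar≡ zero    d _   = refl
  arches++segment ar ar≡ (suc i) d i<ℓ = begin
    (C ++ ar (suc i)) ++ segment α β (suc i) d         ≡⟨ ++-assoc C (ar (suc i)) _ ⟩
    C ++ (ar (suc i) ++ segment α β (suc i) d)         ≡⟨ cong (λ a → C ++ (a ++ segment α β (suc i) d)) (ar≡ (suc i) (s≤s z≤n) i<ℓ) ⟩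
    C ++ ((α i ++ β (suc i)) ++ segment α β (suc i) d) ≡⟨ cong (C ++_) (++-assoc (α i) (β (suc i)) _) ⟩
    C ++ segment α β i (suc d)                          ≡⟨ arches++segment ar ar≡ i (suc d) (≤-trans (n≤1+n i) i<ℓ) ⟩
    segment α β 0 (i + suc d)                           ≡⟨ cong (segment α β 0) (+-suc i d) ⟩
    segment α β 0 (suc i + d)                           ∎
    where
    C : Word σ
    C = concatUpTo ar i

  module _ {ℓ} (ar' : ℕ → Word σ) (ra≡ : ∀ t → 1 ≤ t → t ≤ ℓ → reverse (ar' (ℓ ∸ t + 1)) ≡ β t ++ α t) where

    segment≡α++reverse-arches : ∀ i n → i + n ≡ ℓ → segment α β i n ≡ α i ++ reverse (concatUpTo ar' n)
    segment≡α++reverse-arches i zero    _      = sym (++-identityʳ (α i))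
    segment≡α++reverse-arches i (suc m) i+n≡ℓ = begin
      α i ++ (β (suc i) ++ segment α β (suc i) m)                  ≡⟨ cong (λ s → α i ++ (β (suc i) ++ s)) (segment≡α++reverse-arches (suc i) m i+1+m≡ℓ) ⟩
      α i ++ (β (suc i) ++ (α (suc i) ++ R))                        ≡⟨ cong (α i ++_) (sym (++-assoc (β (suc i)) (α (suc i)) R)) ⟩
      α i ++ ((β (suc i) ++ α (suc i)) ++ R)                        ≡⟨ cong (λ a → α i ++ (a ++ R)) (sym ra-suc-i) ⟩
      α i ++ (reverse (ar' (suc m)) ++ R)                           ≡⟨ cong (α i ++_) (sym (reverse-++ (concatUpTo ar' m) (ar' (suc m)))) ⟩
      α i ++ reverse (concatUpTo ar' m ++ ar' (suc m))              ∎
      where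
      R : Word σ
      R = reverse (concatUpTo ar' m)
      i+1+m≡ℓ : suc i + m ≡ ℓ
      i+1+m≡ℓ = trans (sym (+-suc i m)) i+n≡ℓ
      ra-suc-i : reverse (ar' (suc m)) ≡ β (suc i) ++ α (suc i)
      ra-suc-i = subst (λ t → reverse (ar' t) ≡ β (suc i) ++ α (suc i)) index
                   (ra≡ (suc i) (s≤s z≤n) (≤-trans (m≤m+n (suc i) m) (≤-reflexive i+1+m≡ℓ)))
        where
        index : ℓ ∸ suc i + 1 ≡ suc m
        index = trans (cong (λ l → l ∸ suc i + 1) (sym i+1+m≡ℓ)) (trans (cong (_+ 1) (m+n∸m≡n (suc i) m)) (+-comm m 1))

    segment-split : ∀ i d e → i + (d + e) ≡ ℓ → segment α β i (d + e) ≡ segment α β i d ++ reverse (concatUpTo ar' e)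
    segment-split i zero    e i+e≡ℓ = segment≡α++reverse-arches i e i+e≡ℓ
    segment-split i (suc d) e i+d+e≡ℓ = begin
      α i ++ (β (suc i) ++ segment α β (suc i) (d + e))  ≡⟨ cong (λ s → α i ++ (β (suc i) ++ s)) (segment-split (suc i) d e (trans (sym (+-suc i (d + e))) i+d+e≡ℓ)) ⟩
      α i ++ (β (suc i) ++ (segment α β (suc i) d ++ R)) ≡⟨ cong (α i ++_) (sym (++-assoc (β (suc i)) _ R)) ⟩
      α i ++ ((β (suc i) ++ segment α β (suc i) d) ++ R) ≡⟨ sym (++-assoc (α i) _ R) ⟩
      segment α β i (suc d) ++ R                         ∎
      where
      R : Word σ
      R = reverse (concatUpTo ar' e)

ABFact-framed : ∀ {σ ℓ} {w : Word σ} {α β} → ABFact w ℓ α β →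
                ∀ i d e → i + (d + e) ≡ ℓ → Framed i e w (segment α β i d)
ABFact-framed {w = w} {α} {β} (ar , _ , (_ , arches , _) , ar' , _ , (_ , arches' , _) , w≡ , ar≡ , ra≡ , _ , _) i d e refl =
  concatUpTo ar i , reverse (concatUpTo ar' e) , split ,
  arches-tight i (Arches-≤ (m≤m+n i (d + e)) arches) ,
  Tightˡ-reverse (arches-tight e (Arches-≤ (≤-trans (m≤n+m e d) (m≤n+m (d + e) i)) arches'))
  where
  open ≡-Reasoning
  split : w ≡ concatUpTo ar i ++ segment α β i d ++ reverse (concatUpTo ar' e)
  split = begin
    w                                                            ≡⟨ w≡ ⟩
    segment α β 0 (i + (d + e))                                  ≡⟨ sym (arches++segment α β ar ar≡ i (d + e) (m≤m+n i (d + e))) ⟩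
    concatUpTo ar i ++ segment α β i (d + e)                     ≡⟨ cong (concatUpTo ar i ++_) (segment-split α β ar' ra≡ i d e refl) ⟩
    concatUpTo ar i ++ segment α β i d ++ reverse (concatUpTo ar' e) ∎

segment-≲ : ∀ {σ k ℓ} {w w̃ : Word σ} {α β α̃ β̃} → w ≲[ k ] w̃ → ℓ ≤ k →
            ABFact w ℓ α β → ABFact w̃ ℓ α̃ β̃ → ∀ i d e → i + (d + e) ≡ ℓ →
            segment α β i d ≲[ (k ∸ ℓ) + d ] segment α̃ β̃ i d
segment-≲ {k = k} {ℓ} w≲w̃ ℓ≤k fact fact̃ i d e i+d+e≡ℓ =
  framed-≲ w≲w̃ (ABFact-framed fact i d e i+d+e≡ℓ) (ABFact-framed fact̃ i d e i+d+e≡ℓ) (≤-reflexive bound)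
  where
  open ≡-Reasoning
  bound : i + (((k ∸ ℓ) + d) + e) ≡ k
  bound = begin
    i + (((k ∸ ℓ) + d) + e)  ≡⟨ rearrange i (k ∸ ℓ) d e ⟩
    (k ∸ ℓ) + (i + (d + e))  ≡⟨ cong ((k ∸ ℓ) +_) i+d+e≡ℓ ⟩
    (k ∸ ℓ) + ℓ              ≡⟨ m∸n+n≡m ℓ≤k ⟩
    k                        ∎
    where
    rearrange : ∀ a b c d → a + ((b + c) + d) ≡ b + (a + (c + d))
    rearrange = solve-∀

lemma4 : (σ k : ℕ) (w w̃ : Word σ) (ℓ : ℕ) →
    w ∼[ k ] w̃ → IsIota w ℓ → IsIota w̃ ℓ → ℓ < k →
    (α β α̃ β̃ : ℕ → Word σ) → ABFact w ℓ α β → ABFact w̃ ℓ α̃ β̃ →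
    ∀ i j → i ≤ j → j ≤ ℓ →
    segment α β i (j ∸ i) ∼[ (k ∸ ℓ) + (j ∸ i) ] segment α̃ β̃ i (j ∸ i)
lemma4 σ k w w̃ ℓ w∼w̃ _ _ ℓ<k α β α̃ β̃ fact fact̃ i j i≤j j≤ℓ x ∣x∣≤ =
  segment-≲ (λ y ∣y∣≤k → proj₁ (w∼w̃ y ∣y∣≤k)) (<⇒≤ ℓ<k) fact fact̃ i (j ∸ i) (ℓ ∸ j) i+d+e≡ℓ x ∣x∣≤ ,
  segment-≲ (λ y ∣y∣≤k → proj₂ (w∼w̃ y ∣y∣≤k)) (<⇒≤ ℓ<k) fact̃ fact i (j ∸ i) (ℓ ∸ j) i+d+e≡ℓ x ∣x∣≤
  where
  i+d+e≡ℓ : i + ((j ∸ i) + (ℓ ∸ j)) ≡ ℓ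
  i+d+e≡ℓ = trans (sym (+-assoc i (j ∸ i) (ℓ ∸ j))) (trans (cong (_+ (ℓ ∸ j)) (m+[n∸m]≡n i≤j)) (m+[n∸m]≡n j≤ℓ))
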